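{- For all suspension combinations $T, T'$, if $T\to_l T'$ then $\sigma(T)\to_a\sigma(T')$.
   Context: Syntax. Fix a ring of scalars; $\alpha,\beta$ range over it. Terms: $M,N,L ::= V \mid MN \mid \alpha.M \mid M+N$; values $V,W ::= B \mid 0 \mid \alpha.V \mid V+W$; base values $B ::= x \mid \lambda x.M$. Terms are taken up to $\alpha$-conversion. Rewrite rules. $(A)$: $(M+N)L \to ML+NL$; $(\alpha.M)N \to \alpha.(MN)$; $(0)M \to 0$. $(\xi_{\lambda_{lin}})$: if $M\to M'$ then $VM \to VM'$, $V$ a value. $(A_l)$: $(M+N)V \to MV+NV$; $(\alpha.M)V \to \alpha.(MV)$; $(0)V \to 0$, $V$ a value. $(A_r)$: $B(M+N)\to BM+BN$; $B(\alpha.M)\to \alpha.(BM)$; $B(0)\to 0$, $B$ a base value. $(L)$: $M+(N+L)\to(M+N)+L$; $(M+N)+L\to M+(N+L)$; $M+N\to N+M$; $\alpha.M+\beta.M\to(\alpha+\beta).M$; $\alpha.M+M\to(\alpha+1).M$; $M+M\to(1+1).M$; $\alpha.(\beta.M)\to(\alpha\beta).M$; $\alpha.(M+N)\to\alpha.M+\alpha.N$; $1.M\to M$; $0.M\to 0$; $\alpha.0\to 0$; $0+M\to M$. $(\xi)$: if $M\to M'$ then $MN\to M'N$, $M+N\to M'+N$, $N+M\to N+M'$, $\alpha.M\to\alpha.M'$. $\to_a$ is the relation generated by $A\cup L\cup\xi$ and $\to_l$ the relation generated by $A_l\cup A_r\cup L\cup\xi\cup\xi_{\lambda_{lin}}$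 (context rules applying to the relation being defined). CPS grammar. Base computations $C ::= KB \mid BSK \mid TK$; computation combinations $D ::= C \mid 0 \mid \alpha.D \mid D_1+D_2$; base suspensions $S ::= x \mid \lambda k.C$; suspension combinations $T ::= S \mid 0 \mid \alpha.T \mid T_1+T_2$; continuations $K ::= k \mid \lambda b.bSK$; CPS-values $B ::= \lambda x.S$. Here $x$ ranges over ordinary variables, $k,b$ are reserved variables; $k$ occurs only as the continuation $k$ and as the binder in $\lambda k.C$; $b$ occurs only where displayed. Inverse translation: $\overline{KB}=\underline{K}[\phi(B)]$; $\overline{BSK}=\underline{K}[\phi(B)\sigma(S)]$; $\overline{TK}=\underline{K}[\sigma(T)]$; $\overline{0}=0$; $\overline{\alpha.D}=\alpha.\overline{D}$; $\overline{D_1+D_2}=\overline{D_1}+\overline{D_2}$; $\sigma(x)=x$; $\sigma(\lambda k.C)=\overline{C}$; $\sigma(0)=0$; $\sigma(\alpha.T)=\alpha.\sigma(T)$; $\sigma(T_1+T_2)=\sigma(T_1)+\sigma(T_2)$; $\phi(\lambda x.S)=\lambda x.\sigma(S)$; for a term $M$: $\underline{k}[M]=M$; $\underline{\lambda b.bSK}[M]=\underline{K}[M\,\sigma(S)]$. -}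

module Defs where

open import Level using (Level)
open import Data.Nat using (ℕ; zero; suc)
open import Data.List using (List; []; _∷_)
open import Algebra.Bundles using (Ring)

-- Terms of the linear-algebraic lambda calculus, up to α-conversion,
-- represented with de Bruijn indices.  Scalars range over a set A
-- (instantiated with the carrier of the ring of scalars).

infixl 7 _·_
infixl 6 _⊕_
infixl 8 _$_

data Term {a : Level} (A : Set a) : Set a where
  var  : ℕ → Term A
  lam  : Term A → Term A
  _$_  : Term A → Term A → Term A
  _·_  : A → Term A → Term A
  _⊕_  : Term A → Term A → Term A
  𝟎    : Term A

module _ {a : Level} {A : Set a} where

  data IsBase : Term A → Set a where
    base-var : ∀ {i} → IsBase (var i)
    base-lam : ∀ {M} → IsBase (lam M)

  data IsValue : Term A → Set a where
    val-base : ∀ {B} → IsBase B → IsValue B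
    val-0    : IsValue 𝟎
    val-·    : ∀ {α V} → IsValue V → IsValue (α · V)
    val-⊕    : ∀ {V W} → IsValue V → IsValue W → IsValue (V ⊕ W)

module Rules {c ℓ : Level} (R : Ring c ℓ) where
  open Ring R using (Carrier; 0#; 1#) renaming (_+_ to _+ᵣ_; _*_ to _*ᵣ_)

  Tm : Set c
  Tm = Term Carrier

  data RuleA : Tm → Tm → Set c where
    A-dist : ∀ {M N L} → RuleA ((M ⊕ N) $ L) ((M $ L) ⊕ (N $ L))
    A-scal : ∀ {α M N} → RuleA ((α · M) $ N) (α · (M $ N))
    A-zero : ∀ {M} → RuleA (𝟎 $ M) 𝟎

  data RuleAl : Tm → Tm → Set c where
    Al-dist : ∀ {M N V} → IsValue V → RuleAl ((M ⊕ N) $ V) ((M $ V) ⊕ (N $ V))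
    Al-scal : ∀ {α M V} → IsValue V → RuleAl ((α · M) $ V) (α · (M $ V))
    Al-zero : ∀ {V} → IsValue V → RuleAl (𝟎 $ V) 𝟎

  data RuleAr : Tm → Tm → Set c where
    Ar-dist : ∀ {B M N} → IsBase B → RuleAr (B $ (M ⊕ N)) ((B $ M) ⊕ (B $ N))
    Ar-scal : ∀ {B α M} → IsBase B → RuleAr (B $ (α · M)) (α · (B $ M))
    Ar-zero : ∀ {B} → IsBase B → RuleAr (B $ 𝟎) 𝟎

  data RuleL : Tm → Tm → Set c where
    L-assocˡ : ∀ {M N L} → RuleL (M ⊕ (N ⊕ L)) ((M ⊕ N) ⊕ L)
    L-assocʳ : ∀ {M N L} → RuleL ((M ⊕ N) ⊕ L) (M ⊕ (N ⊕ L))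
    L-comm   : ∀ {M N} → RuleL (M ⊕ N) (N ⊕ M)
    L-fact   : ∀ {α β M} → RuleL ((α · M) ⊕ (β · M)) ((α +ᵣ β) · M)
    L-fact1  : ∀ {α M} → RuleL ((α · M) ⊕ M) ((α +ᵣ 1#) · M)
    L-fact2  : ∀ {M} → RuleL (M ⊕ M) ((1# +ᵣ 1#) · M)
    L-scal   : ∀ {α β M} → RuleL (α · (β · M)) ((α *ᵣ β) · M)
    L-dist   : ∀ {α M N} → RuleL (α · (M ⊕ N)) ((α · M) ⊕ (α · N))
    L-one    : ∀ {M} → RuleL (1# · M) M
    L-zeroˢ  : ∀ {M} → RuleL (0# · M) 𝟎
    L-zeroᵗ  : ∀ {α} → RuleL (α · 𝟎) 𝟎
    L-unit   : ∀ {M} → RuleL (𝟎 ⊕ M) M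

  infix 4 _⟶a_ _⟶l_

  data _⟶a_ : Tm → Tm → Set c where
    a-A   : ∀ {M N} → RuleA M N → M ⟶a N
    a-L   : ∀ {M N} → RuleL M N → M ⟶a N
    a-ξ$  : ∀ {M M' N} → M ⟶a M' → (M $ N) ⟶a (M' $ N)
    a-ξ⊕ˡ : ∀ {M M' N} → M ⟶a M' → (M ⊕ N) ⟶a (M' ⊕ N)
    a-ξ⊕ʳ : ∀ {M M' N} → M ⟶a M' → (N ⊕ M) ⟶a (N ⊕ M')
    a-ξ·  : ∀ {α M M'} → M ⟶a M' → (α · M) ⟶a (α · M')

  data _⟶l_ : Tm → Tm → Set c where
    l-Al  : ∀ {M N} → RuleAl M N → M ⟶l N
    l-Ar  : ∀ {M N} → RuleAr M N → M ⟶l N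
    l-L   : ∀ {M N} → RuleL M N → M ⟶l N
    l-ξ$  : ∀ {M M' N} → M ⟶l M' → (M $ N) ⟶l (M' $ N)
    l-ξ⊕ˡ : ∀ {M M' N} → M ⟶l M' → (M ⊕ N) ⟶l (M' ⊕ N)
    l-ξ⊕ʳ : ∀ {M M' N} → M ⟶l M' → (N ⊕ M) ⟶l (N ⊕ M')
    l-ξ·  : ∀ {α M M'} → M ⟶l M' → (α · M) ⟶l (α · M')
    l-ξlin : ∀ {V M M'} → IsValue V → M ⟶l M' → (V $ M) ⟶l (V $ M')

-- CPS grammar, scoped over a context of binder kinds:
--   ord = ordinary variable x, kon = reserved k, bnd = reserved b.

data Kind : Set where
  ord kon bnd : Kind

Ctx : Set
Ctx = List Kind

data OVar : Ctx → Set where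
  here  : ∀ {Γ} → OVar (ord ∷ Γ)
  there : ∀ {κ Γ} → OVar Γ → OVar (κ ∷ Γ)

-- the reserved variable k: refers to the innermost λk binder
-- (only λb binders may lie in between, by the shape of the grammar)
data KRef : Ctx → Set where
  kz : ∀ {Γ} → KRef (kon ∷ Γ)
  ks : ∀ {Γ} → KRef Γ → KRef (bnd ∷ Γ)

module _ {a : Level} (A : Set a) where
  mutual
    data Comp (Γ : Ctx) : Set a where
      cKB  : Cont Γ → CVal Γ → Comp Γ
      cBSK : CVal Γ → BSusp Γ → Cont Γ → Comp Γ
      cTK  : SComb Γ → Cont Γ → Comp Γ

    data BSusp (Γ : Ctx) : Set a where
      sVar : OVar Γ → BSusp Γ
      sLam : Comp (kon ∷ Γ) → BSusp Γ

    data SComb (Γ : Ctx) : Set a where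
      tS    : BSusp Γ → SComb Γ
      t0    : SComb Γ
      tScal : A → SComb Γ → SComb Γ
      tPlus : SComb Γ → SComb Γ → SComb Γ

    data Cont (Γ : Ctx) : Set a where
      kVar : KRef Γ → Cont Γ
      kLam : BSusp (bnd ∷ Γ) → Cont (bnd ∷ Γ) → Cont Γ

    data CVal (Γ : Ctx) : Set a where
      bLam : BSusp (ord ∷ Γ) → CVal Γ

module _ {a : Level} {A : Set a} where

  ovarIdx : ∀ {Γ} → OVar Γ → ℕ
  ovarIdx here      = zero
  ovarIdx (there x) = suc (ovarIdx x)

  krefIdx : ∀ {Γ} → KRef Γ → ℕ
  krefIdx kz     = zero
  krefIdx (ks r) = suc (krefIdx r)

  -- CPS syntax viewed as a term (the k and b binders are ordinary λ's)
  mutual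
    ⌜_⌝C : ∀ {Γ} → Comp A Γ → Term A
    ⌜ cKB K B ⌝C     = ⌜ K ⌝K $ ⌜ B ⌝B
    ⌜ cBSK B S K ⌝C  = (⌜ B ⌝B $ ⌜ S ⌝S) $ ⌜ K ⌝K
    ⌜ cTK T K ⌝C     = ⌜ T ⌝T $ ⌜ K ⌝K

    ⌜_⌝S : ∀ {Γ} → BSusp A Γ → Term A
    ⌜ sVar x ⌝S = var (ovarIdx x)
    ⌜ sLam C ⌝S = lam ⌜ C ⌝C

    ⌜_⌝T : ∀ {Γ} → SComb A Γ → Term A
    ⌜ tS S ⌝T        = ⌜ S ⌝S
    ⌜ t0 ⌝T          = 𝟎
    ⌜ tScal α T ⌝T   = α · ⌜ T ⌝T
    ⌜ tPlus T₁ T₂ ⌝T = ⌜ T₁ ⌝T ⊕ ⌜ T₂ ⌝T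

    ⌜_⌝K : ∀ {Γ} → Cont A Γ → Term A
    ⌜ kVar r ⌝K   = var (krefIdx r)
    ⌜ kLam S K ⌝K = lam ((var zero $ ⌜ S ⌝S) $ ⌜ K ⌝K)

    ⌜_⌝B : ∀ {Γ} → CVal A Γ → Term A
    ⌜ bLam S ⌝B = lam ⌜ S ⌝S

  -- de Bruijn index of an ordinary variable once the k/b binders are
  -- erased by the inverse translation
  σIdx : ∀ {Γ} → OVar Γ → ℕ
  σIdx here                = zero
  σIdx (there {ord} x)     = suc (σIdx x)
  σIdx (there {kon} x)     = σIdx x
  σIdx (there {bnd} x)     = σIdx x

  mutual
    overline : ∀ {Γ} → Comp A Γ → Term A
    overline (cKB K B)    = plug K (φ B)
    overline (cBSK B S K) = plug K (φ B $ σS S)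
    overline (cTK T K)    = plug K (σ T)

    σS : ∀ {Γ} → BSusp A Γ → Term A
    σS (sVar x) = var (σIdx x)
    σS (sLam C) = overline C

    σ : ∀ {Γ} → SComb A Γ → Term A
    σ (tS S)        = σS S
    σ t0            = 𝟎
    σ (tScal α T)   = α · σ T
    σ (tPlus T₁ T₂) = σ T₁ ⊕ σ T₂

    φ : ∀ {Γ} → CVal A Γ → Term A
    φ (bLam S) = lam (σS S)

    plug : ∀ {Γ} → Cont A Γ → Term A → Term A
    plug (kVar _)   M = M
    plug (kLam S K) M = plug K (M $ σS S)

module Submission where

-- Codes of suspension combinations are values (built from variables,
-- abstractions, 0, α.– and –+–), so no application-rooted rule (A_l),
-- (A_r), ξ-under-application or ξ_λlin can fire at the root of such a
-- code: every →l step out of ⌜T⌝ is an (L) rule or a ξ-congruence under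
-- + or α.–.  Inverting the shape of ⌜T⌝ against the rule's left-hand
-- side, the step lifts to a combination T'' with ⌜T''⌝ = result, and
-- since σ commutes with 0, α.– and –+–, the same rule applies to σ T.
-- Rules with repeated metavariables (α.M + β.M, M + M, …) need that
-- equal codes come from equal combinations; this is injectivity of the
-- embedding ⌜_⌝, proved first for all CPS categories simultaneously.
-- The theorem then follows: the lifted T'' has the code of T', hence
-- equals T'.

open import Defs
open import Level using (Level)
open import Data.Nat using (ℕ)
open import Data.Nat.Properties using (suc-injective)
open import Data.List using (replicate)
open import Data.Product using (Σ-syntax; _×_; _,_; proj₂)
open import Data.Empty using (⊥-elim)
open import Relation.Nullary using (¬_)
open import Algebra.Bundles using (Ring)
open import Relation.Binary.PropositionalEquality
  using (_≡_; _≢_; refl; sym; cong; cong₂; subst)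

module Codes {a : Level} {A : Set a} where

  $-injective : ∀ {M N M' N' : Term A} → M $ N ≡ M' $ N' → M ≡ M' × N ≡ N'
  $-injective refl = refl , refl

  lam-injective : ∀ {M N : Term A} → lam M ≡ lam N → M ≡ N
  lam-injective refl = refl

  var-injective : ∀ {i j} → var {A = A} i ≡ var j → i ≡ j
  var-injective refl = refl

  ovarIdx-injective : ∀ {Γ} (x y : OVar Γ) → ovarIdx {A = A} x ≡ ovarIdx {A = A} y → x ≡ y
  ovarIdx-injective here      here      _ = refl
  ovarIdx-injective (there x) (there y) e = cong there (ovarIdx-injective x y (suc-injective e))
  ovarIdx-injective here      (there _) ()
  ovarIdx-injective (there _) here      ()

  krefIdx-injective : ∀ {Γ} (r r' : KRef Γ) → krefIdx {A = A} r ≡ krefIdx {A = A} r' → r ≡ r'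
  krefIdx-injective kz     kz      _ = refl
  krefIdx-injective (ks r) (ks r') e = cong ks (krefIdx-injective r r' (suc-injective e))

  value-notApp : ∀ {V M N : Term A} → IsValue V → ¬ (V ≡ M $ N)
  value-notApp (val-base base-var) ()
  value-notApp (val-base base-lam) ()
  value-notApp val-0               ()
  value-notApp (val-· _)           ()
  value-notApp (val-⊕ _ _)         ()

  susp-isBase : ∀ {Γ} (S : BSusp A Γ) → IsBase ⌜ S ⌝S
  susp-isBase (sVar _) = base-var
  susp-isBase (sLam _) = base-lam

  cont-isBase : ∀ {Γ} (K : Cont A Γ) → IsBase ⌜ K ⌝K
  cont-isBase (kVar _)   = base-var
  cont-isBase (kLam _ _) = base-lam

  comb-isValue : ∀ {Γ} (T : SComb A Γ) → IsValue ⌜ T ⌝T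
  comb-isValue (tS S)        = val-base (susp-isBase S)
  comb-isValue t0            = val-0
  comb-isValue (tScal _ T)   = val-· (comb-isValue T)
  comb-isValue (tPlus T₁ T₂) = val-⊕ (comb-isValue T₁) (comb-isValue T₂)

  -- A CPS-value λx.S never has the code of a continuation λb.bSK,
  -- whose body is an application.
  cval≢cont : ∀ {Γ} (B : CVal A Γ) (K : Cont A Γ) → ⌜ B ⌝B ≢ ⌜ K ⌝K
  cval≢cont (bLam S) (kVar _)   ()
  cval≢cont (bLam S) (kLam _ _) e =
    value-notApp (val-base (susp-isBase S)) (lam-injective e)

  baseInv : ∀ {Γ} (T : SComb A Γ) → IsBase ⌜ T ⌝T → Σ[ S ∈ BSusp A Γ ] T ≡ tS S
  baseInv (tS S) _ = S , refl
  baseInv t0 ()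
  baseInv (tScal _ _) ()
  baseInv (tPlus _ _) ()

  zeroInv : ∀ {Γ} (T : SComb A Γ) → ⌜ T ⌝T ≡ 𝟎 → T ≡ t0
  zeroInv (tS (sVar _)) ()
  zeroInv (tS (sLam _)) ()
  zeroInv t0            _ = refl
  zeroInv (tScal _ _)   ()
  zeroInv (tPlus _ _)   ()

  scalInv : ∀ {Γ} (T : SComb A Γ) {α M} → ⌜ T ⌝T ≡ α · M →
            Σ[ T₁ ∈ SComb A Γ ] T ≡ tScal α T₁ × ⌜ T₁ ⌝T ≡ M
  scalInv (tS (sVar _)) ()
  scalInv (tS (sLam _)) ()
  scalInv t0            ()
  scalInv (tScal _ T₁)  refl = T₁ , refl , refl
  scalInv (tPlus _ _)   ()

  plusInv : ∀ {Γ} (T : SComb A Γ) {M N} → ⌜ T ⌝T ≡ M ⊕ N →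
            Σ[ T₁ ∈ SComb A Γ ] Σ[ T₂ ∈ SComb A Γ ]
              T ≡ tPlus T₁ T₂ × ⌜ T₁ ⌝T ≡ M × ⌜ T₂ ⌝T ≡ N
  plusInv (tS (sVar _)) ()
  plusInv (tS (sLam _)) ()
  plusInv t0            ()
  plusInv (tScal _ _)   ()
  plusInv (tPlus T₁ T₂) refl = T₁ , T₂ , refl , refl , refl

  -- The three kinds of base computation have pairwise distinct codes:
  -- K B has a base value in head position, B S K an application, and
  -- T K a continuation (not a CPS-value) in argument position.
  KB≢BSK : ∀ {Γ} (K K' : Cont A Γ) (B B' : CVal A Γ) (S : BSusp A Γ) → ⌜ cKB K B ⌝C ≢ ⌜ cBSK B' S K' ⌝C
  KB≢BSK K _ _ _ _ e with $-injective e
  ... | eK , _ = value-notApp (val-base (cont-isBase K)) eK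

  KB≢TK : ∀ {Γ} (K K' : Cont A Γ) (B : CVal A Γ) (T : SComb A Γ) → ⌜ cKB K B ⌝C ≢ ⌜ cTK T K' ⌝C
  KB≢TK _ K' B _ e with $-injective e
  ... | _ , eB = cval≢cont B K' eB

  BSK≢TK : ∀ {Γ} (K K' : Cont A Γ) (B : CVal A Γ) (S : BSusp A Γ) (T : SComb A Γ) → ⌜ cBSK B S K ⌝C ≢ ⌜ cTK T K' ⌝C
  BSK≢TK _ _ _ _ T e with $-injective e
  ... | eBS , _ = value-notApp (comb-isValue T) (sym eBS)

  mutual
    ⌜⌝C-injective : ∀ {Γ} (C C' : Comp A Γ) → ⌜ C ⌝C ≡ ⌜ C' ⌝C → C ≡ C'
    ⌜⌝C-injective (cKB K B) (cKB K' B') e with $-injective e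
    ... | eK , eB = cong₂ cKB (⌜⌝K-injective K K' eK) (⌜⌝B-injective B B' eB)
    ⌜⌝C-injective (cBSK B S K) (cBSK B' S' K') e with $-injective e
    ... | eBS , eK with $-injective eBS
    ... | eB , eS
      with ⌜⌝B-injective B B' eB | ⌜⌝S-injective S S' eS | ⌜⌝K-injective K K' eK
    ... | refl | refl | refl = refl
    ⌜⌝C-injective (cTK T K) (cTK T' K') e with $-injective e
    ... | eT , eK = cong₂ cTK (⌜⌝T-injective T T' eT) (⌜⌝K-injective K K' eK)
    ⌜⌝C-injective (cKB K B) (cBSK B' S K') e = ⊥-elim (KB≢BSK K K' B B' S e)
    ⌜⌝C-injective (cKB K B) (cTK T K') e     = ⊥-elim (KB≢TK K K' B T e)
    ⌜⌝C-injective (cBSK B S K) (cKB K' B') e = ⊥-elim (KB≢BSK K' K B' B S (sym e))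
    ⌜⌝C-injective (cBSK B S K) (cTK T K') e  = ⊥-elim (BSK≢TK K K' B S T e)
    ⌜⌝C-injective (cTK T K) (cKB K' B) e     = ⊥-elim (KB≢TK K' K B T (sym e))
    ⌜⌝C-injective (cTK T K) (cBSK B S K') e  = ⊥-elim (BSK≢TK K' K B S T (sym e))

    ⌜⌝S-injective : ∀ {Γ} (S S' : BSusp A Γ) → ⌜ S ⌝S ≡ ⌜ S' ⌝S → S ≡ S'
    ⌜⌝S-injective (sVar x) (sVar y)  e = cong sVar (ovarIdx-injective x y (var-injective e))
    ⌜⌝S-injective (sLam C) (sLam C') e = cong sLam (⌜⌝C-injective C C' (lam-injective e))
    ⌜⌝S-injective (sVar _) (sLam _)  ()
    ⌜⌝S-injective (sLam _) (sVar _)  ()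

    ⌜⌝T-injective : ∀ {Γ} (T T' : SComb A Γ) → ⌜ T ⌝T ≡ ⌜ T' ⌝T → T ≡ T'
    ⌜⌝T-injective (tS S) T' e
      with baseInv T' (subst IsBase e (susp-isBase S))
    ... | S' , refl = cong tS (⌜⌝S-injective S S' e)
    ⌜⌝T-injective t0 T' e = sym (zeroInv T' (sym e))
    ⌜⌝T-injective (tScal α T) T' e with scalInv T' (sym e)
    ... | U , refl , eU = cong (tScal α) (⌜⌝T-injective T U (sym eU))
    ⌜⌝T-injective (tPlus T₁ T₂) T' e with plusInv T' (sym e)
    ... | U₁ , U₂ , refl , e₁ , e₂ =
      cong₂ tPlus (⌜⌝T-injective T₁ U₁ (sym e₁)) (⌜⌝T-injective T₂ U₂ (sym e₂))

    ⌜⌝K-injective : ∀ {Γ} (K K' : Cont A Γ) → ⌜ K ⌝K ≡ ⌜ K' ⌝K → K ≡ K'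
    ⌜⌝K-injective (kVar r) (kVar r') e = cong kVar (krefIdx-injective r r' (var-injective e))
    ⌜⌝K-injective (kLam S K) (kLam S' K') e with $-injective (lam-injective e)
    ... | eS , eK =
      cong₂ kLam (⌜⌝S-injective S S' (proj₂ ($-injective eS))) (⌜⌝K-injective K K' eK)
    ⌜⌝K-injective (kVar _)   (kLam _ _) ()
    ⌜⌝K-injective (kLam _ _) (kVar _)   ()

    ⌜⌝B-injective : ∀ {Γ} (B B' : CVal A Γ) → ⌜ B ⌝B ≡ ⌜ B' ⌝B → B ≡ B'
    ⌜⌝B-injective (bLam S) (bLam S') e = cong bLam (⌜⌝S-injective S S' (lam-injective e))

module Lifting {c ℓ : Level} (R : Ring c ℓ) where
  open Ring R using (Carrier)
  open Rules R
  open Codes {A = Carrier}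

  Lift : ∀ {Γ} → SComb Carrier Γ → Tm → Set c
  Lift {Γ} T N = Σ[ T' ∈ SComb Carrier Γ ] ⌜ T' ⌝T ≡ N × σ T ⟶a σ T'

  -- Repeated metavariables are matched by injectivity.
  liftL : ∀ {Γ} {M N} → RuleL M N → (T : SComb Carrier Γ) → ⌜ T ⌝T ≡ M → Lift T N
  liftL L-assocˡ T e with plusInv T e
  ... | T₁ , T₂₃ , refl , refl , e₂₃ with plusInv T₂₃ e₂₃
  ... | T₂ , T₃ , refl , refl , refl = tPlus (tPlus T₁ T₂) T₃ , refl , a-L L-assocˡ
  liftL L-assocʳ T e with plusInv T e
  ... | T₁₂ , T₃ , refl , e₁₂ , refl with plusInv T₁₂ e₁₂
  ... | T₁ , T₂ , refl , refl , refl = tPlus T₁ (tPlus T₂ T₃) , refl , a-L L-assocʳ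
  liftL L-comm T e with plusInv T e
  ... | T₁ , T₂ , refl , refl , refl = tPlus T₂ T₁ , refl , a-L L-comm
  liftL L-fact T e with plusInv T e
  ... | U₁ , U₂ , refl , e₁ , e₂ with scalInv U₁ e₁
  ... | T₁ , refl , refl with scalInv U₂ e₂
  ... | T₂ , refl , e₁₂ with ⌜⌝T-injective T₂ T₁ e₁₂
  ... | refl = tScal _ T₁ , refl , a-L L-fact
  liftL L-fact1 T e with plusInv T e
  ... | U₁ , T₂ , refl , e₁ , e₂ with scalInv U₁ e₁
  ... | T₁ , refl , refl with ⌜⌝T-injective T₂ T₁ e₂
  ... | refl = tScal _ T₁ , refl , a-L L-fact1
  liftL L-fact2 T e with plusInv T e
  ... | T₁ , T₂ , refl , refl , e₂ with ⌜⌝T-injective T₂ T₁ e₂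
  ... | refl = tScal _ T₁ , refl , a-L L-fact2
  liftL L-scal T e with scalInv T e
  ... | U , refl , eU with scalInv U eU
  ... | T₁ , refl , refl = tScal _ T₁ , refl , a-L L-scal
  liftL L-dist T e with scalInv T e
  ... | U , refl , eU with plusInv U eU
  ... | T₁ , T₂ , refl , refl , refl = tPlus (tScal _ T₁) (tScal _ T₂) , refl , a-L L-dist
  liftL L-one T e with scalInv T e
  ... | T₁ , refl , refl = T₁ , refl , a-L L-one
  liftL L-zeroˢ T e with scalInv T e
  ... | T₁ , refl , refl = t0 , refl , a-L L-zeroˢ
  liftL L-zeroᵗ T e with scalInv T e
  ... | T₁ , refl , e₁ with zeroInv T₁ e₁
  ... | refl = t0 , refl , a-L L-zeroᵗ
  liftL L-unit T e with plusInv T e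
  ... | T₁ , T₂ , refl , e₁ , refl with zeroInv T₁ e₁
  ... | refl = T₂ , refl , a-L L-unit

  lift : ∀ {Γ} {M N} → M ⟶l N → (T : SComb Carrier Γ) → ⌜ T ⌝T ≡ M → Lift T N
  lift (l-L r) T e = liftL r T e
  lift (l-ξ⊕ˡ d) T e with plusInv T e
  ... | T₁ , T₂ , refl , refl , refl with lift d T₁ refl
  ... | T₁' , refl , r = tPlus T₁' T₂ , refl , a-ξ⊕ˡ r
  lift (l-ξ⊕ʳ d) T e with plusInv T e
  ... | T₁ , T₂ , refl , refl , refl with lift d T₂ refl
  ... | T₂' , refl , r = tPlus T₁ T₂' , refl , a-ξ⊕ʳ r
  lift (l-ξ· d) T e with scalInv T e
  ... | T₁ , refl , refl with lift d T₁ refl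
  ... | T₁' , refl , r = tScal _ T₁' , refl , a-ξ· r
  lift (l-Al (Al-dist _)) T e = ⊥-elim (value-notApp (comb-isValue T) e)
  lift (l-Al (Al-scal _)) T e = ⊥-elim (value-notApp (comb-isValue T) e)
  lift (l-Al (Al-zero _)) T e = ⊥-elim (value-notApp (comb-isValue T) e)
  lift (l-Ar (Ar-dist _)) T e = ⊥-elim (value-notApp (comb-isValue T) e)
  lift (l-Ar (Ar-scal _)) T e = ⊥-elim (value-notApp (comb-isValue T) e)
  lift (l-Ar (Ar-zero _)) T e = ⊥-elim (value-notApp (comb-isValue T) e)
  lift (l-ξ$ _)           T e = ⊥-elim (value-notApp (comb-isValue T) e)
  lift (l-ξlin _ _)       T e = ⊥-elim (value-notApp (comb-isValue T) e)

lemma4p13 : ∀ {c ℓ : Level} (R : Ring c ℓ) (n : ℕ)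
            (T T' : SComb (Ring.Carrier R) (replicate n ord)) →
            Rules._⟶l_ R ⌜ T ⌝T ⌜ T' ⌝T →
            Rules._⟶a_ R (σ T) (σ T')
lemma4p13 R _ T T' step with Lifting.lift R step T refl
... | T'' , code≡ , σ-step =
  subst (λ U → Rules._⟶a_ R (σ T) (σ U)) (Codes.⌜⌝T-injective T'' T' code≡) σ-step
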